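{- Let $s$ be an unambiguous term and $u,v$ F-terms such that $s\sqsubseteq u\le v$ and for every $\alpha\in\mathrm{TV}(v)$ there is $p\in\mathrm{Poss}(v)$ with $\alpha\in\mathrm{TV}(\mathrm{tpOf}(v,p))$ and $\mathrm{mtpOf}(s,p)\neq\bot$. Then $u$ is the unique F-term $u'$ such that $s\sqsubseteq u'\le v$.
   Context: Types: fix infinite sets of type variables (tyvars) and term variables, type constructors $\kappa$ with arities, types $\sigma ::= \alpha \mid \sigma\Rightarrow\tau \mid (\sigma_1,\dots,\sigma_n)\,\kappa$, constants $c$. A substitution $\rho$ maps tyvars to types with finite support; $\sigma[\rho]$ its application; $\mathrm{TV}(\sigma)$ the tyvars of $\sigma$. Maybe-types: types or $\bot$, with $\mathrm{TV}(\bot)=\emptyset$. Terms: $t ::= x_\xi \mid c_\xi \mid (t_1\,t_2)_\xi \mid (\lambda x_\xi.\,t)_\zeta$ with $\xi,\zeta$ maybe-types; $t[\rho]$ applies $\rho$ to all decorations, $\mathrm{TV}(t)$ is the union of tyvars of all decorations, and $t\le s$ iff $t=s[\rho]$ for some $\rho$. Unambiguous: no two binders $\lambda x_\xi,\lambda x_\zeta$ with the same $x$ at different positions. F-term: all decorations are types. Positions: $\mathrm{Poss}(x_\xi)=\mathrm{Poss}(c_\xi)=\{[]\}$, $\mathrm{Poss}((t\,s)_\xi)=\{[]\}\cup1\cdot\mathrm{Poss}(t)\cup2\cdot\mathrm{Poss}(s)$, $\mathrm{Poss}((\lambda x_\xi.t)_\zeta)=\{[],[1]\}\cup2\cdot\mathrm{Poss}(t)$.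 $\mathrm{mtpOf}(t,p)$ is the decoration at position $p$: the node's own decoration for $p=[]$, the binder's decoration for $p=[1]$ in an abstraction, and recursively $\mathrm{mtpOf}(t_i,p')$ for $p=i\cdot p'$ in an application (resp. $\mathrm{mtpOf}(t,p')$ for $p=2\cdot p'$ in an abstraction). For F-terms it is written $\mathrm{tpOf}(v,p)$. Annotation subsumption: $\xi\sqsubseteq\zeta$ iff $\xi\in\{\bot,\zeta\}$; on terms $x_\xi\sqsubseteq x_\zeta$, $c_\xi\sqsubseteq c_\zeta$ iff $\xi\sqsubseteq\zeta$, and $(s\,t)_\xi\sqsubseteq(s'\,t')_{\xi'}$, $(\lambda x_\zeta.t)_\xi\sqsubseteq(\lambda x_{\zeta'}.t')_{\xi'}$ iff componentwise. -}

module Defs where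

open import Data.Nat using (ℕ; zero; suc; _≥_)
open import Data.Vec using (Vec; []; _∷_)
open import Data.List using (List; []; _∷_)
open import Data.Maybe using (Maybe; just; nothing)
open import Data.Product using (Σ; ∃; _×_; _,_)
open import Data.Sum using (_⊎_)
open import Relation.Binary.PropositionalEquality using (_≡_)
open import Relation.Nullary using (¬_)

-- Type variables, term variables, constants: ℕ.
-- Type constructors: a name together with its arity n; the type
-- (σ₁,…,σₙ) κ is  tcon κ n (σ₁ ∷ … ∷ σₙ ∷ []).
TyVar : Set
TyVar = ℕ

Var : Set
Var = ℕ

Const : Set
Const = ℕ

data Ty : Set where
  tvar : TyVar → Ty
  _⇒_  : Ty → Ty → Ty
  tcon : (κ : ℕ) (n : ℕ) → Vec Ty n → Ty

Subst : Set
Subst = TyVar → Ty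

FiniteSupport : Subst → Set
FiniteSupport ρ = ∃ λ N → ∀ α → α ≥ N → ρ α ≡ tvar α

mutual
  _[_]ᵗ : Ty → Subst → Ty
  tvar α [ ρ ]ᵗ = ρ α
  (σ ⇒ τ) [ ρ ]ᵗ = (σ [ ρ ]ᵗ) ⇒ (τ [ ρ ]ᵗ)
  tcon κ n σs [ ρ ]ᵗ = tcon κ n (σs [ ρ ]ᵛ)

  _[_]ᵛ : ∀ {n} → Vec Ty n → Subst → Vec Ty n
  [] [ ρ ]ᵛ = []
  (σ ∷ σs) [ ρ ]ᵛ = (σ [ ρ ]ᵗ) ∷ (σs [ ρ ]ᵛ)

mutual
  data _∈TV_ (α : TyVar) : Ty → Set where
    tv-var : α ∈TV tvar α
    tv-⇒ˡ  : ∀ {σ τ} → α ∈TV σ → α ∈TV (σ ⇒ τ)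
    tv-⇒ʳ  : ∀ {σ τ} → α ∈TV τ → α ∈TV (σ ⇒ τ)
    tv-con : ∀ {κ n σs} → α ∈TVᵛ σs → α ∈TV tcon κ n σs

  data _∈TVᵛ_ (α : TyVar) : ∀ {n} → Vec Ty n → Set where
    here  : ∀ {n σ} {σs : Vec Ty n} → α ∈TV σ → α ∈TVᵛ (σ ∷ σs)
    there : ∀ {n σ} {σs : Vec Ty n} → α ∈TVᵛ σs → α ∈TVᵛ (σ ∷ σs)

-- Maybe-types: nothing plays the role of ⊥.
MTy : Set
MTy = Maybe Ty

data _∈TVₘ_ (α : TyVar) : MTy → Set where
  tvm : ∀ {σ} → α ∈TV σ → α ∈TVₘ just σ

_[_]ₘ : MTy → Subst → MTy
just σ [ ρ ]ₘ = just (σ [ ρ ]ᵗ)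
nothing [ ρ ]ₘ = nothing

data Term : Set where
  var   : Var → MTy → Term
  const : Const → MTy → Term
  app   : Term → Term → MTy → Term
  lam   : Var → MTy → Term → MTy → Term   -- lam x ξ t ζ = (λ x_ξ. t)_ζ

_[_] : Term → Subst → Term
var x ξ [ ρ ] = var x (ξ [ ρ ]ₘ)
const c ξ [ ρ ] = const c (ξ [ ρ ]ₘ)
app t s ξ [ ρ ] = app (t [ ρ ]) (s [ ρ ]) (ξ [ ρ ]ₘ)
lam x ξ t ζ [ ρ ] = lam x (ξ [ ρ ]ₘ) (t [ ρ ]) (ζ [ ρ ]ₘ)

data _∈TVₜ_ (α : TyVar) : Term → Set where
  tv-var   : ∀ {x ξ} → α ∈TVₘ ξ → α ∈TVₜ var x ξ
  tv-const : ∀ {c ξ} → α ∈TVₘ ξ → α ∈TVₜ const c ξ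
  tv-app₀  : ∀ {t s ξ} → α ∈TVₘ ξ → α ∈TVₜ app t s ξ
  tv-app₁  : ∀ {t s ξ} → α ∈TVₜ t → α ∈TVₜ app t s ξ
  tv-app₂  : ∀ {t s ξ} → α ∈TVₜ s → α ∈TVₜ app t s ξ
  tv-lam₀  : ∀ {x ξ t ζ} → α ∈TVₘ ζ → α ∈TVₜ lam x ξ t ζ
  tv-lam₁  : ∀ {x ξ t ζ} → α ∈TVₘ ξ → α ∈TVₜ lam x ξ t ζ
  tv-lam₂  : ∀ {x ξ t ζ} → α ∈TVₜ t → α ∈TVₜ lam x ξ t ζ

_≤ₜ_ : Term → Term → Set
t ≤ₜ s = Σ Subst λ ρ → FiniteSupport ρ × (t ≡ s [ ρ ])

data IsTy : MTy → Set where
  isTy : ∀ {σ} → IsTy (just σ)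

data FTerm : Term → Set where
  f-var   : ∀ {x ξ} → IsTy ξ → FTerm (var x ξ)
  f-const : ∀ {c ξ} → IsTy ξ → FTerm (const c ξ)
  f-app   : ∀ {t s ξ} → FTerm t → FTerm s → IsTy ξ → FTerm (app t s ξ)
  f-lam   : ∀ {x ξ t ζ} → IsTy ξ → FTerm t → IsTy ζ → FTerm (lam x ξ t ζ)

Pos : Set
Pos = List ℕ

data _∈Poss_ : Pos → Term → Set where
  p-var    : ∀ {x ξ} → [] ∈Poss var x ξ
  p-const  : ∀ {c ξ} → [] ∈Poss const c ξ
  p-app₀   : ∀ {t s ξ} → [] ∈Poss app t s ξ
  p-app₁   : ∀ {t s ξ p} → p ∈Poss t → (1 ∷ p) ∈Poss app t s ξ
  p-app₂   : ∀ {t s ξ p} → p ∈Poss s → (2 ∷ p) ∈Poss app t s ξ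
  p-lam₀   : ∀ {x ξ t ζ} → [] ∈Poss lam x ξ t ζ
  p-lam₁   : ∀ {x ξ t ζ} → (1 ∷ []) ∈Poss lam x ξ t ζ
  p-lam₂   : ∀ {x ξ t ζ p} → p ∈Poss t → (2 ∷ p) ∈Poss lam x ξ t ζ

-- mtpOf(t,p); on positions outside Poss(t) it returns ⊥ (irrelevant
-- for the statement, which only uses positions in Poss).
mtpOf : Term → Pos → MTy
mtpOf (var x ξ) [] = ξ
mtpOf (const c ξ) [] = ξ
mtpOf (app t s ξ) [] = ξ
mtpOf (app t s ξ) (1 ∷ p) = mtpOf t p
mtpOf (app t s ξ) (2 ∷ p) = mtpOf s p
mtpOf (lam x ξ t ζ) [] = ζ
mtpOf (lam x ξ t ζ) (1 ∷ []) = ξ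
mtpOf (lam x ξ t ζ) (2 ∷ p) = mtpOf t p
mtpOf _ _ = nothing

data Binds : Term → Pos → Var → Set where
  b-here : ∀ {x ξ t ζ} → Binds (lam x ξ t ζ) [] x
  b-app₁ : ∀ {t s ξ p x} → Binds t p x → Binds (app t s ξ) (1 ∷ p) x
  b-app₂ : ∀ {t s ξ p x} → Binds s p x → Binds (app t s ξ) (2 ∷ p) x
  b-lam₂ : ∀ {y ξ t ζ p x} → Binds t p x → Binds (lam y ξ t ζ) (2 ∷ p) x

Unambiguous : Term → Set
Unambiguous t = ∀ {x p q} → Binds t p x → Binds t q x → p ≡ q

data _⊑ₘ_ : MTy → MTy → Set where
  ⊑-bot  : ∀ {ζ} → nothing ⊑ₘ ζ
  ⊑-refl : ∀ {ζ} → ζ ⊑ₘ ζ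

data _⊑_ : Term → Term → Set where
  ⊑-var   : ∀ {x ξ ζ} → ξ ⊑ₘ ζ → var x ξ ⊑ var x ζ
  ⊑-const : ∀ {c ξ ζ} → ξ ⊑ₘ ζ → const c ξ ⊑ const c ζ
  ⊑-app   : ∀ {s t s' t' ξ ξ'} → s ⊑ s' → t ⊑ t' → ξ ⊑ₘ ξ' → app s t ξ ⊑ app s' t' ξ'
  ⊑-lam   : ∀ {x ζ ζ' t t' ξ ξ'} → ζ ⊑ₘ ζ' → t ⊑ t' → ξ ⊑ₘ ξ' → lam x ζ t ξ ⊑ lam x ζ' t' ξ'

{-# OPTIONS --safe #-}
-- Write u = v[ρ] and u' = v[ρ']. At a position p where s carries a type,
-- s ⊑ u and s ⊑ u' force u and u' to carry that same type there, so
-- τ[ρ] = τ[ρ'] for the type τ of v at p, i.e. ρ and ρ' agree on TV(τ).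
-- By the covering hypothesis every tyvar of v lies in such a τ, so ρ and
-- ρ' agree on TV(v), and therefore v[ρ] = v[ρ'].
module Submission where

open import Defs
open import Data.Vec using (Vec; []; _∷_)
open import Data.Maybe using (just; nothing)
open import Data.Maybe.Properties using (just-injective)
open import Data.Product using (∃; _×_; _,_)
open import Data.Empty using (⊥-elim)
open import Function using (_∘_)
import Data.Vec.Properties as Vec
open import Relation.Binary.PropositionalEquality
  using (_≡_; _≢_; refl; sym; trans; cong; cong₂)

cong₃ : ∀ {A B C D : Set} (f : A → B → C → D) {a a' b b' c c'} →
        a ≡ a' → b ≡ b' → c ≡ c' → f a b c ≡ f a' b' c'
cong₃ f refl refl refl = refl

AgreeOn : (TyVar → Set) → Subst → Subst → Set
AgreeOn P ρ ρ' = ∀ {α} → P α → ρ α ≡ ρ' α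

⇒-injectiveˡ : ∀ {σ τ σ' τ'} → σ ⇒ τ ≡ σ' ⇒ τ' → σ ≡ σ'
⇒-injectiveˡ refl = refl

⇒-injectiveʳ : ∀ {σ τ σ' τ'} → σ ⇒ τ ≡ σ' ⇒ τ' → τ ≡ τ'
⇒-injectiveʳ refl = refl

tcon-injective : ∀ {κ n} {σs σs' : Vec Ty n} → tcon κ n σs ≡ tcon κ n σs' → σs ≡ σs'
tcon-injective refl = refl

mutual
  agree⇒[]ᵗ≡ : ∀ σ {ρ ρ'} → AgreeOn (_∈TV σ) ρ ρ' → σ [ ρ ]ᵗ ≡ σ [ ρ' ]ᵗ
  agree⇒[]ᵗ≡ (tvar α) agree = agree tv-var
  agree⇒[]ᵗ≡ (σ ⇒ τ) agree =
    cong₂ _⇒_ (agree⇒[]ᵗ≡ σ (agree ∘ tv-⇒ˡ)) (agree⇒[]ᵗ≡ τ (agree ∘ tv-⇒ʳ))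
  agree⇒[]ᵗ≡ (tcon κ n σs) agree = cong (tcon κ n) (agree⇒[]ᵛ≡ σs (agree ∘ tv-con))

  agree⇒[]ᵛ≡ : ∀ {n} (σs : Vec Ty n) {ρ ρ'} → AgreeOn (_∈TVᵛ σs) ρ ρ' → σs [ ρ ]ᵛ ≡ σs [ ρ' ]ᵛ
  agree⇒[]ᵛ≡ [] agree = refl
  agree⇒[]ᵛ≡ (σ ∷ σs) agree =
    cong₂ _∷_ (agree⇒[]ᵗ≡ σ (agree ∘ here)) (agree⇒[]ᵛ≡ σs (agree ∘ there))

agree⇒[]ₘ≡ : ∀ ξ {ρ ρ'} → AgreeOn (_∈TVₘ ξ) ρ ρ' → ξ [ ρ ]ₘ ≡ ξ [ ρ' ]ₘ
agree⇒[]ₘ≡ (just σ) agree = cong just (agree⇒[]ᵗ≡ σ (agree ∘ tvm))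
agree⇒[]ₘ≡ nothing agree = refl

agree⇒[]≡ : ∀ t {ρ ρ'} → AgreeOn (_∈TVₜ t) ρ ρ' → t [ ρ ] ≡ t [ ρ' ]
agree⇒[]≡ (var x ξ) agree = cong (var x) (agree⇒[]ₘ≡ ξ (agree ∘ tv-var))
agree⇒[]≡ (const c ξ) agree = cong (const c) (agree⇒[]ₘ≡ ξ (agree ∘ tv-const))
agree⇒[]≡ (app t s ξ) agree =
  cong₃ app (agree⇒[]≡ t (agree ∘ tv-app₁))
            (agree⇒[]≡ s (agree ∘ tv-app₂))
            (agree⇒[]ₘ≡ ξ (agree ∘ tv-app₀))
agree⇒[]≡ (lam x ξ t ζ) agree =
  cong₃ (lam x) (agree⇒[]ₘ≡ ξ (agree ∘ tv-lam₁))
                (agree⇒[]≡ t (agree ∘ tv-lam₂))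
                (agree⇒[]ₘ≡ ζ (agree ∘ tv-lam₀))

mutual
  []ᵗ≡⇒agree : ∀ σ {ρ ρ'} → σ [ ρ ]ᵗ ≡ σ [ ρ' ]ᵗ → AgreeOn (_∈TV σ) ρ ρ'
  []ᵗ≡⇒agree (tvar α) eq tv-var = eq
  []ᵗ≡⇒agree (σ ⇒ τ) eq (tv-⇒ˡ α∈σ) = []ᵗ≡⇒agree σ (⇒-injectiveˡ eq) α∈σ
  []ᵗ≡⇒agree (σ ⇒ τ) eq (tv-⇒ʳ α∈τ) = []ᵗ≡⇒agree τ (⇒-injectiveʳ eq) α∈τ
  []ᵗ≡⇒agree (tcon κ n σs) eq (tv-con α∈σs) = []ᵛ≡⇒agree σs (tcon-injective eq) α∈σs

  []ᵛ≡⇒agree : ∀ {n} (σs : Vec Ty n) {ρ ρ'} → σs [ ρ ]ᵛ ≡ σs [ ρ' ]ᵛ → AgreeOn (_∈TVᵛ σs) ρ ρ'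
  []ᵛ≡⇒agree (σ ∷ σs) eq (here α∈σ) = []ᵗ≡⇒agree σ (Vec.∷-injectiveˡ eq) α∈σ
  []ᵛ≡⇒agree (σ ∷ σs) eq (there α∈σs) = []ᵛ≡⇒agree σs (Vec.∷-injectiveʳ eq) α∈σs

⊑ₘ-defined⇒≡ : ∀ {ξ ζ} → ξ ⊑ₘ ζ → ξ ≢ nothing → ξ ≡ ζ
⊑ₘ-defined⇒≡ ⊑-bot ξ≢⊥ = ⊥-elim (ξ≢⊥ refl)
⊑ₘ-defined⇒≡ ⊑-refl _ = refl

⊑[]⇒mtpOf-⊑ₘ : ∀ {s v p ρ} → s ⊑ (v [ ρ ]) → p ∈Poss v → mtpOf s p ⊑ₘ (mtpOf v p [ ρ ]ₘ)
⊑[]⇒mtpOf-⊑ₘ (⊑-var ξ⊑) p-var = ξ⊑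
⊑[]⇒mtpOf-⊑ₘ (⊑-const ξ⊑) p-const = ξ⊑
⊑[]⇒mtpOf-⊑ₘ (⊑-app _ _ ξ⊑) p-app₀ = ξ⊑
⊑[]⇒mtpOf-⊑ₘ (⊑-app t⊑ _ _) (p-app₁ p∈t) = ⊑[]⇒mtpOf-⊑ₘ t⊑ p∈t
⊑[]⇒mtpOf-⊑ₘ (⊑-app _ s⊑ _) (p-app₂ p∈s) = ⊑[]⇒mtpOf-⊑ₘ s⊑ p∈s
⊑[]⇒mtpOf-⊑ₘ (⊑-lam _ _ ζ⊑) p-lam₀ = ζ⊑
⊑[]⇒mtpOf-⊑ₘ (⊑-lam ξ⊑ _ _) p-lam₁ = ξ⊑
⊑[]⇒mtpOf-⊑ₘ (⊑-lam _ t⊑ _) (p-lam₂ p∈t) = ⊑[]⇒mtpOf-⊑ₘ t⊑ p∈t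

lemma1 : (s u v : Term) → Unambiguous s → FTerm u → FTerm v →
    s ⊑ u → u ≤ₜ v →
    (∀ α → α ∈TVₜ v →
      ∃ λ p → p ∈Poss v × (∃ λ τ → mtpOf v p ≡ just τ × α ∈TV τ) × mtpOf s p ≢ nothing) →
    ∀ u' → FTerm u' → s ⊑ u' → u' ≤ₜ v → u' ≡ u
lemma1 s _ v _ _ _ s⊑u (ρ , _ , refl) covered _ _ s⊑u' (ρ' , _ , refl) =
  agree⇒[]≡ v (λ {α} α∈v → agree-at (covered α α∈v))
  where
  agree-at : ∀ {α} →
    (∃ λ p → p ∈Poss v × (∃ λ τ → mtpOf v p ≡ just τ × α ∈TV τ) × mtpOf s p ≢ nothing) →
    ρ' α ≡ ρ α
  agree-at (p , p∈v , (τ , v-at-p≡τ , α∈τ) , s-at-p≢⊥) =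
    []ᵗ≡⇒agree τ (just-injective (trans (sym (s-at-p≡ s⊑u')) (s-at-p≡ s⊑u))) α∈τ
    where
    s-at-p≡ : ∀ {r} → s ⊑ (v [ r ]) → mtpOf s p ≡ just (τ [ r ]ᵗ)
    s-at-p≡ s⊑v[r] =
      trans (⊑ₘ-defined⇒≡ (⊑[]⇒mtpOf-⊑ₘ s⊑v[r] p∈v) s-at-p≢⊥) (cong (_[ _ ]ₘ) v-at-p≡τ)
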